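{- For every integer $m\ge 2$, the metric dimension of $(K_n\times P_m)\odot K_1$ equals $n-1$ if $n\ge 4$, and equals $3$ if $n=3$.
   Context: All graphs are finite, simple and connected. For vertices $u,v$, $d(u,v)$ is the length of a shortest $u$–$v$ path. For an ordered set $S=\{s_1,\dots,s_k\}$ of vertices of $G$, the metric representation of $v$ is $r(v|S)=(d(v,s_1),\dots,d(v,s_k))$; $S$ is a resolving set if $r(u|S)\ne r(v|S)$ for all distinct vertices $u,v$. The metric dimension $\dim(G)$ is the minimum cardinality of a resolving set. $K_n$ is the complete graph on $n$ vertices, $P_m$ the path on $m$ vertices, $K_1$ the single-vertex graph. The Cartesian product $G\times H$ has vertex set $V(G)\times V(H)$, with $(g,h)\sim(g',h')$ iff ($g=g'$ and $h\sim h'$) or ($g\sim g'$ and $h=h'$). The corona product $G\odot H$ (with $G$ of order $n$) is obtained from one copy of $G$ and $n$ copies of $H$ by joining every vertex of the $i$-th copy of $H$ to the $i$-th vertex of $G$; thus $G\odot K_1$ is $G$ with one pendant vertex attached to each vertex. -}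

module Defs where

open import Data.Nat using (ℕ; zero; suc; _≤_)
open import Data.Fin using (Fin; toℕ)
open import Data.Product using (_×_; _,_; ∃; ∃-syntax)
open import Data.Sum using (_⊎_; inj₁; inj₂)
open import Data.Empty using (⊥)
open import Data.List using (List; length)
open import Data.List.Membership.Propositional using (_∈_)
open import Data.List.Relation.Unary.Unique.Propositional using (Unique)
open import Relation.Binary.PropositionalEquality using (_≡_; _≢_)

record Graph : Set₁ where
  field
    V   : Set
    Adj : V → V → Set
open Graph public

data Walk (G : Graph) : V G → V G → ℕ → Set where
  here : ∀ {u} → Walk G u u zero
  step : ∀ {u w v n} → Adj G u w → Walk G w v n → Walk G u v (suc n)

-- d(u,v) = k : there is a u–v walk of length k and none shorter
-- (a shortest walk is a shortest path).
Dist : (G : Graph) → V G → V G → ℕ → Set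
Dist G u v k = Walk G u v k × (∀ m → Walk G u v m → k ≤ m)

Resolving : (G : Graph) → List (V G) → Set
Resolving G S =
  ∀ u v → (∀ s → s ∈ S → ∃[ k ] (Dist G u s k × Dist G v s k)) → u ≡ v

MetricDim : Graph → ℕ → Set
MetricDim G d =
  (∃[ S ] (Unique S × length S ≡ d × Resolving G S))
  × (∀ S → Unique S → Resolving G S → d ≤ length S)

K : ℕ → Graph
K n = record { V = Fin n ; Adj = λ i j → i ≢ j }

P : ℕ → Graph
P m = record { V = Fin m
             ; Adj = λ i j → (toℕ j ≡ suc (toℕ i)) ⊎ (toℕ i ≡ suc (toℕ j)) }

_□_ : Graph → Graph → Graph
G □ H = record
  { V = V G × V H
  ; Adj = λ { (g , h) (g' , h') → (g ≡ g' × Adj H h h') ⊎ (Adj G g g' × h ≡ h') } }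

-- Corona product G ⊙ H: inj₁ g is the vertex g of G,
-- inj₂ (g , h) is the vertex h of the copy of H attached to g.
CoronaAdj : (G H : Graph) → V G ⊎ (V G × V H) → V G ⊎ (V G × V H) → Set
CoronaAdj G H (inj₁ g)        (inj₁ g')         = Adj G g g'
CoronaAdj G H (inj₁ g)        (inj₂ (g' , h'))  = g ≡ g'
CoronaAdj G H (inj₂ (g , h))  (inj₁ g')         = g ≡ g'
CoronaAdj G H (inj₂ (g , h))  (inj₂ (g' , h'))  = g ≡ g' × Adj H h h'

_⊙_ : Graph → Graph → Graph
G ⊙ H = record { V = V G ⊎ (V G × V H) ; Adj = CoronaAdj G H }

module Submission where

-- A "metric" on a graph is a function that vanishes on the diagonal,
-- changes by at most one along an edge and is realised by walks; it then coincides
-- with the graph distance (Dist), so resolvability can be checked on it.  Such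
-- metrics are given for K n (the discrete metric δ) and P m (|i - j|), and are
-- transported to Cartesian products (sum) and to coronas with K 1 (pendant vertices
-- add one each).  This yields an explicit distance on the graph Γ n m of the theorem.
--
-- Two bases in the same column of rows i ≠ i′ are twins for every
-- vertex outside both rows, so a resolving set meets all rows but one: n - 1 ≤ |S|
-- (pigeonhole).  For n = 3 two vertices never suffice: if they share a row the previous
-- argument applies, otherwise an explicit pair of vertices is confused.
--
-- The bottoms (a , 0) of rows a ∈ A together with the top (t , m-1) of a
-- row t resolve Γ n m as soon as A has two rows and t ∷ A misses at most one row:
-- the bottoms determine the height (pendancy plus column) and the δ-profile, and the top
-- then separates pendancy, column and the remaining rows.  Choosing A, t gives n - 1
-- landmarks for n ≥ 4 and 3 for n = 3.

open import Defs
open import Data.Nat using (ℕ; zero; suc; _+_; _∸_; _≤_; _<_; z≤n; s≤s; ∣_-_∣)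
open import Data.Nat.Properties
open import Data.Fin as Fin using (Fin; toℕ; fromℕ; fromℕ<; inject₁)
open import Data.Fin.Properties using (toℕ-injective; toℕ<n; toℕ-fromℕ<; toℕ-fromℕ; toℕ-inject₁; pigeonhole; ¬∀⟶∃¬)
import Data.Fin.Properties as Finₚ
open import Data.Product using (_×_; _,_; ∃-syntax; proj₁; proj₂)
open import Data.Sum using (_⊎_; inj₁; inj₂)
open import Data.Empty using (⊥; ⊥-elim)
open import Data.List using (List; []; _∷_; length; map; lookup; tabulate)
open import Data.List.Properties using (length-map; length-tabulate)
open import Data.List.Membership.Propositional using (_∈_; _∉_)
open import Data.List.Membership.Propositional.Properties using (∈-map⁺; ∈-tabulate⁺)
open import Data.List.Relation.Unary.Any using (here; there; index; any?)
open import Data.List.Relation.Unary.Any.Properties using (lookup-index)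
open import Data.List.Relation.Unary.All using (All; []; _∷_)
open import Data.List.Relation.Unary.AllPairs using ([]; _∷_)
open import Data.List.Relation.Unary.Unique.Propositional using (Unique)
import Data.List.Relation.Unary.Unique.Propositional.Properties as Unique
open import Function using (_∘_)
open import Relation.Binary using (tri<; tri≈; tri>)
open import Relation.Binary.PropositionalEquality
open import Relation.Nullary using (¬_; yes; no)
open import Algebra.Properties.CommutativeSemigroup +-commutativeSemigroup using (interchange; x∙yz≈y∙xz)

module _ {G : Graph} where

  _++ʷ_ : ∀ {u w v a b} → Walk G u w a → Walk G w v b → Walk G u v (a + b)
  here     ++ʷ q = q
  step e p ++ʷ q = step e (p ++ʷ q)

  walk-zero : ∀ {u v} → Walk G u v 0 → u ≡ v
  walk-zero here = refl

  reverse : (∀ {u v} → Adj G u v → Adj G v u) →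
            ∀ {u v k} → Walk G u v k → Walk G v u k
  reverse sym-adj here = here
  reverse sym-adj (step {n = k} e p) =
    subst (Walk G _ _) (+-comm k 1) (reverse sym-adj p ++ʷ step (sym-adj e) here)

mapWalk : ∀ {G H : Graph} (f : V G → V H) →
          (∀ {u v} → Adj G u v → Adj H (f u) (f v)) →
          ∀ {u v k} → Walk G u v k → Walk H (f u) (f v) k
mapWalk f f-adj here       = here
mapWalk f f-adj (step e p) = step (f-adj e) (mapWalk f f-adj p)

-- Such a function is exactly the graph distance (see dist-d and d-dist).
record Metric (G : Graph) : Set where
  field
    d      : V G → V G → ℕ
    d-self : ∀ v → d v v ≡ 0
    d-step : ∀ {u w} y → Adj G u w → d u y ≤ suc (d w y)
    d-walk : ∀ u v → Walk G u v (d u v)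

module _ {G : Graph} (μ : Metric G) where
  open Metric μ

  -- No walk is shorter than d: d drops by at most one per step.
  walk-bound : ∀ {u v k} → Walk G u v k → d u v ≤ k
  walk-bound {v = v} here = ≤-reflexive (d-self v)
  walk-bound {v = v} (step e p) = ≤-trans (d-step v e) (s≤s (walk-bound p))

  d-dist : ∀ u v → Dist G u v (d u v)
  d-dist u v = d-walk u v , λ _ → walk-bound

  dist-d : ∀ {u v k} → Dist G u v k → k ≡ d u v
  dist-d {u} {v} (w , shortest) = ≤-antisym (shortest _ (d-walk u v)) (walk-bound w)

  d-zero : ∀ {u v} → d u v ≡ 0 → u ≡ v
  d-zero {u} {v} e = walk-zero (subst (Walk G u v) e (d-walk u v))

  resolving : ∀ {S} → (∀ u v → (∀ s → s ∈ S → d u s ≡ d v s) → u ≡ v) → Resolving G S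
  resolving res u v same = res u v λ s p → let (_ , du , dv) = same s p in
    trans (sym (dist-d du)) (dist-d dv)

  separates : ∀ {S} → Resolving G S → ∀ {u v} → u ≢ v → ¬ (∀ s → s ∈ S → d u s ≡ d v s)
  separates R {u} {v} u≢v same = u≢v (R u v λ s p →
    d u s , d-dist u s , subst (Dist G v s) (sym (same s p)) (d-dist v s))

δ : ∀ {n} → Fin n → Fin n → ℕ
δ i j with i Fin.≟ j
... | yes _ = 0
... | no  _ = 1

δ-refl : ∀ {n} (i : Fin n) → δ i i ≡ 0
δ-refl i with i Fin.≟ i
... | yes _  = refl
... | no i≢i = ⊥-elim (i≢i refl)

δ-≢ : ∀ {n} {i j : Fin n} → i ≢ j → δ i j ≡ 1
δ-≢ {i = i} {j} i≢j with i Fin.≟ j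
... | yes i≡j = ⊥-elim (i≢j i≡j)
... | no  _   = refl

δ≤1 : ∀ {n} (i j : Fin n) → δ i j ≤ 1
δ≤1 i j with i Fin.≟ j
... | yes _ = z≤n
... | no  _ = s≤s z≤n

completeMetric : ∀ n → Metric (K n)
completeMetric n = record { d = δ ; d-self = δ-refl ; d-step = step′ ; d-walk = walk }
  where
    step′ : ∀ {i j} k → i ≢ j → δ i k ≤ suc (δ j k)
    step′ {i} k _ = ≤-trans (δ≤1 i k) (s≤s z≤n)
    walk : ∀ i j → Walk (K n) i j (δ i j)
    walk i j with i Fin.≟ j
    ... | yes refl = here
    ... | no  i≢j  = step i≢j here

gap : ∀ {m} → Fin m → Fin m → ℕ
gap i j = ∣ toℕ i - toℕ j ∣

∣m-1+n∣≡1+∣m-n∣ : ∀ {m n} → m ≤ n → ∣ m - suc n ∣ ≡ suc ∣ m - n ∣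
∣m-1+n∣≡1+∣m-n∣ z≤n     = refl
∣m-1+n∣≡1+∣m-n∣ (s≤s p) = ∣m-1+n∣≡1+∣m-n∣ p

∣n-1+n∣≡1 : ∀ n → ∣ n - suc n ∣ ≡ 1
∣n-1+n∣≡1 n = trans (∣m-1+n∣≡1+∣m-n∣ (≤-refl {n})) (cong suc (∣n-n∣≡0 n))

adjacent-gap : ∀ {m} {i j : Fin m} → Adj (P m) i j → gap i j ≡ 1
adjacent-gap {i = i} (inj₁ e) rewrite e = ∣n-1+n∣≡1 (toℕ i)
adjacent-gap {j = j} (inj₂ e) rewrite e = trans (∣-∣-comm _ (toℕ j)) (∣n-1+n∣≡1 (toℕ j))

pathMetric : ∀ m → Metric (P m)
pathMetric m = record
  { d = gap ; d-self = λ i → ∣n-n∣≡0 (toℕ i) ; d-step = step′ ; d-walk = walk }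
  where
    step′ : ∀ {i j} k → Adj (P m) i j → gap i k ≤ suc (gap j k)
    step′ {i} {j} k e = ≤-trans (∣-∣-triangle (toℕ i) (toℕ j) (toℕ k))
                                (≤-reflexive (cong (_+ gap j k) (adjacent-gap e)))

    climb : ∀ k (i j : Fin m) → toℕ j ≡ k + toℕ i → Walk (P m) i j k
    climb zero    i j e = subst (λ x → Walk (P m) i x 0) (toℕ-injective (sym e)) here
    climb (suc k) i j e = step (inj₁ (toℕ-fromℕ< above)) (climb k (fromℕ< above) j e′)
      where
        above : suc (toℕ i) < m
        above = ≤-<-trans (s≤s (m≤n+m (toℕ i) k)) (subst (_< m) e (toℕ<n j))
        e′ : toℕ j ≡ k + toℕ (fromℕ< above)
        e′ = trans e (trans (sym (+-suc k (toℕ i))) (cong (k +_) (sym (toℕ-fromℕ< above))))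

    mirror : ∀ {i j} → Adj (P m) i j → Adj (P m) j i
    mirror (inj₁ e) = inj₂ e
    mirror (inj₂ e) = inj₁ e

    walk : ∀ i j → Walk (P m) i j (gap i j)
    walk i j with ≤-total (toℕ i) (toℕ j)
    ... | inj₁ i≤j = subst (Walk (P m) i j) (sym (m≤n⇒∣m-n∣≡n∸m i≤j))
                       (climb _ i j (sym (m∸n+n≡m i≤j)))
    ... | inj₂ j≤i = subst (Walk (P m) i j) (sym (m≤n⇒∣n-m∣≡n∸m j≤i))
                       (reverse mirror (climb _ j i (sym (m∸n+n≡m j≤i))))

∣m-n∣≡1+∣1+m-n∣ : ∀ {m n} → m < n → ∣ m - n ∣ ≡ suc ∣ suc m - n ∣
∣m-n∣≡1+∣1+m-n∣ (s≤s m≤n) = ∣m-1+n∣≡1+∣m-n∣ m≤n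

neighbour : ∀ {m′} (j : Fin (2 + m′)) → ∃[ j′ ] gap j′ j ≡ 1
neighbour Fin.zero    = Fin.suc Fin.zero , refl
neighbour (Fin.suc j) = inject₁ j , trans (cong (λ x → ∣ x - suc (toℕ j) ∣) (toℕ-inject₁ j)) (∣n-1+n∣≡1 (toℕ j))

_□ᵐ_ : ∀ {G H} → Metric G → Metric H → Metric (G □ H)
_□ᵐ_ {G} {H} μ ν = record { d = d□ ; d-self = self ; d-step = step′ ; d-walk = walk }
  where
    module μ = Metric μ
    module ν = Metric ν

    d□ : V G × V H → V G × V H → ℕ
    d□ (g , h) (g′ , h′) = μ.d g g′ + ν.d h h′

    self : ∀ v → d□ v v ≡ 0
    self (g , h) = cong₂ _+_ (μ.d-self g) (ν.d-self h)

    step′ : ∀ {u w} y → Adj (G □ H) u w → d□ u y ≤ suc (d□ w y)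
    step′ {g , _} (y , z) (inj₁ (refl , e)) =
      ≤-trans (+-monoʳ-≤ (μ.d g y) (ν.d-step z e)) (≤-reflexive (+-suc _ _))
    step′ (y , z) (inj₂ (e , refl)) = +-monoˡ-≤ _ (μ.d-step y e)

    walk : ∀ u v → Walk (G □ H) u v (d□ u v)
    walk (g , h) (g′ , h′) =
      mapWalk (_, h) (λ e → inj₂ (e , refl)) (μ.d-walk g g′)
      ++ʷ mapWalk (g′ ,_) (λ e → inj₁ (refl , e)) (ν.d-walk h h′)

-- Distance between the two pendant vertices over base vertices at distance k.
leafGap : ℕ → ℕ
leafGap zero    = 0
leafGap (suc k) = 3 + k

-- Distances in G ⊙ K 1: attaching pendants adds one per pendant endpoint.
coronaMetric : ∀ {G} → Metric G → Metric (G ⊙ K 1)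
coronaMetric {G} μ = record
  { d = d⊙ ; d-self = self ; d-step = λ {u} {w} → step′ {u} {w} ; d-walk = walk }
  where
    open Metric μ
    Γ = G ⊙ K 1

    d⊙ : V Γ → V Γ → ℕ
    d⊙ (inj₁ g)       (inj₁ g′)       = d g g′
    d⊙ (inj₁ g)       (inj₂ (g′ , _)) = suc (d g g′)
    d⊙ (inj₂ (g , _)) (inj₁ g′)       = suc (d g g′)
    d⊙ (inj₂ (g , _)) (inj₂ (g′ , _)) = leafGap (d g g′)

    self : ∀ v → d⊙ v v ≡ 0
    self (inj₁ g)       = d-self g
    self (inj₂ (g , _)) = cong leafGap (d-self g)

    k≤leafGap : ∀ k → k ≤ leafGap k
    k≤leafGap zero    = z≤n
    k≤leafGap (suc k) = s≤s (≤-trans (n≤1+n k) (n≤1+n (suc k)))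

    leafGap≤ : ∀ k → leafGap k ≤ 2 + k
    leafGap≤ zero    = z≤n
    leafGap≤ (suc k) = ≤-refl

    step′ : ∀ {u w} y → CoronaAdj G (K 1) u w → d⊙ u y ≤ suc (d⊙ w y)
    step′ {inj₁ g} {inj₁ g′} (inj₁ y)       e    = d-step y e
    step′ {inj₁ g} {inj₁ g′} (inj₂ (y , _)) e    = s≤s (d-step y e)
    step′ {inj₁ g} {inj₂ _}  (inj₁ y)       refl = ≤-trans (n≤1+n _) (n≤1+n _)
    step′ {inj₁ g} {inj₂ _}  (inj₂ (y , _)) refl = s≤s (k≤leafGap (d g y))
    step′ {inj₂ _} {inj₁ g}  (inj₁ y)       refl = ≤-refl
    step′ {inj₂ _} {inj₁ g}  (inj₂ (y , _)) refl = leafGap≤ (d g y)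
    step′ {inj₂ (_ , Fin.zero)} {inj₂ (_ , Fin.zero)} y (_ , 0≢0) = ⊥-elim (0≢0 refl)

    to-leaf : ∀ g g′ z → Walk Γ (inj₁ g) (inj₂ (g′ , z)) (suc (d g g′))
    to-leaf g g′ z = subst (Walk Γ _ _) (+-comm (d g g′) 1)
                       (mapWalk inj₁ (λ e → e) (d-walk g g′) ++ʷ step refl here)

    leaf-walk : ∀ g g′ (z z′ : Fin 1) k → d g g′ ≡ k →
                Walk Γ (inj₂ (g , z)) (inj₂ (g′ , z′)) (leafGap k)
    leaf-walk g g′ Fin.zero Fin.zero zero e
      rewrite d-zero μ e = here
    leaf-walk g g′ z z′ (suc k) e = step refl (subst (λ x → Walk Γ _ _ (suc x)) e (to-leaf g g′ z′))

    walk : ∀ u v → Walk Γ u v (d⊙ u v)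
    walk (inj₁ g)       (inj₁ g′)        = mapWalk inj₁ (λ e → e) (d-walk g g′)
    walk (inj₁ g)       (inj₂ (g′ , z′)) = to-leaf g g′ z′
    walk (inj₂ (g , z)) (inj₁ g′)        = step refl (mapWalk inj₁ (λ e → e) (d-walk g g′))
    walk (inj₂ (g , z)) (inj₂ (g′ , z′)) = leaf-walk g g′ z z′ _ refl

missing : ∀ {n} (L : List (Fin n)) → length L < n → ∃[ i ] i ∉ L
missing {n} L short = ¬∀⟶∃¬ n (_∈ L) (λ i → any? (i Fin.≟_) L) covers-not
  where
    covers-not : ¬ (∀ i → i ∈ L)
    covers-not covers with pigeonhole short (λ i → index (covers i))
    ... | i , j , i<j , same-index = Finₚ.<⇒≢ i<j
      (trans (lookup-index (covers i)) (trans (cong (lookup L) same-index) (sym (lookup-index (covers j)))))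

missing-two : ∀ {n} (L : List (Fin n)) → 2 + length L ≤ n → ∃[ i ] ∃[ i′ ] (i ≢ i′ × i ∉ L × i′ ∉ L)
missing-two L short with missing L (≤-trans (n≤1+n _) short)
... | i , i∉ with missing (i ∷ L) short
... | i′ , i′∉ = i , i′ , (λ e → i′∉ (here (sym e))) , i∉ , (λ p → i′∉ (there p))

Γ : ℕ → ℕ → Graph
Γ n m = (K n □ P m) ⊙ K 1

Vertex : ℕ → ℕ → Set
Vertex n m = V (Γ n m)

gridMetric : ∀ n m → Metric (Γ n m)
gridMetric n m = coronaMetric (completeMetric n □ᵐ pathMetric m)

dist : ∀ {n m} → Vertex n m → Vertex n m → ℕ
dist {n} {m} = Metric.d (gridMetric n m)

module _ {n m : ℕ} where

  row : Vertex n m → Fin n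
  row (inj₁ (i , _))       = i
  row (inj₂ ((i , _) , _)) = i

  col : Vertex n m → Fin m
  col (inj₁ (_ , j))       = j
  col (inj₂ ((_ , j) , _)) = j

  pen : Vertex n m → ℕ
  pen (inj₁ _) = 0
  pen (inj₂ _) = 1

  vertex-ext : ∀ u v → row u ≡ row v → col u ≡ col v → pen u ≡ pen v → u ≡ v
  vertex-ext (inj₁ _)                    (inj₁ _)                    refl refl _ = refl
  vertex-ext (inj₂ (_ , Fin.zero))       (inj₂ (_ , Fin.zero))       refl refl _ = refl
  vertex-ext (inj₁ _) (inj₂ _) _ _ ()
  vertex-ext (inj₂ _) (inj₁ _) _ _ ()

  dist-to-base : ∀ x a j → dist x (inj₁ (a , j)) ≡ pen x + (δ (row x) a + gap (col x) j)
  dist-to-base (inj₁ _) a j = refl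
  dist-to-base (inj₂ _) a j = refl

  dist-from-base : ∀ i j s → dist (inj₁ (i , j)) s ≡ pen s + (δ i (row s) + gap j (col s))
  dist-from-base i j (inj₁ _) = refl
  dist-from-base i j (inj₂ _) = refl

  same-from-bases : ∀ {i i′ j j′} s → δ i (row s) + gap j (col s) ≡ δ i′ (row s) + gap j′ (col s) →
                    dist (inj₁ (i , j)) s ≡ dist (inj₁ (i′ , j′)) s
  same-from-bases {i} {i′} {j} {j′} s e =
    trans (dist-from-base i j s) (trans (cong (pen s +_) e) (sym (dist-from-base i′ j′ s)))

  rowsOf : List (Vertex n m) → List (Fin n)
  rowsOf = map row

  avoids : ∀ {S i s} → i ∉ rowsOf S → s ∈ S → row s ≢ i
  avoids i∉ s∈ e = i∉ (subst (_∈ _) e (∈-map⁺ row s∈))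

  row-twins : ∀ {i i′} (j : Fin m) (s : Vertex n m) → row s ≢ i → row s ≢ i′ →
              dist (inj₁ (i , j)) s ≡ dist (inj₁ (i′ , j)) s
  row-twins j s ≢i ≢i′ = same-from-bases s
    (cong (_+ gap j (col s)) (trans (δ-≢ (≢i ∘ sym)) (sym (δ-≢ (≢i′ ∘ sym)))))

  rows-hit : ∀ {S} → Resolving (Γ n m) S → Fin m → ∀ {i i′} → i ≢ i′ →
             i ∉ rowsOf S → i′ ∉ rowsOf S → ⊥
  rows-hit {S} R j {i} {i′} i≢i′ i∉ i′∉ =
    separates (gridMetric n m) R {inj₁ (i , j)} {inj₁ (i′ , j)} (λ e → i≢i′ (cong row e))
      λ s s∈ → row-twins j s (avoids i∉ s∈) (avoids i′∉ s∈)

  lower-bound : Fin m → ∀ S → Resolving (Γ n m) S → n ∸ 1 ≤ length S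
  lower-bound j S R = ≮⇒≥ λ short →
    let (i , i′ , i≢i′ , i∉ , i′∉) = missing-two (rowsOf S) (room n (length-rows short))
    in rows-hit R j i≢i′ i∉ i′∉
    where
      length-rows : length S < n ∸ 1 → length (rowsOf S) < n ∸ 1
      length-rows = subst (_< n ∸ 1) (sym (length-map row S))
      room : ∀ n {k} → k < n ∸ 1 → 2 + k ≤ n
      room (suc n) k<n = s≤s k<n

  Confuse : Vertex n m → Vertex n m → Set
  Confuse s₁ s₂ = ∃[ u ] ∃[ v ] (u ≢ v × dist u s₁ ≡ dist v s₁ × dist u s₂ ≡ dist v s₂)

  confuse-swap : ∀ {s₁ s₂} → Confuse s₁ s₂ → Confuse s₂ s₁
  confuse-swap (u , v , u≢v , e₁ , e₂) = u , v , u≢v , e₂ , e₁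

  no-resolving-confused : ∀ {s₁ s₂} → Confuse s₁ s₂ → ¬ Resolving (Γ n m) (s₁ ∷ s₂ ∷ [])
  no-resolving-confused (u , v , u≢v , e₁ , e₂) R = separates (gridMetric n m) R u≢v same
    where
      same : ∀ s → s ∈ _ → dist u s ≡ dist v s
      same _ (here refl)         = e₁
      same _ (there (here refl)) = e₂

  -- Landmarks in different rows and columns j₁ < j₂ confuse the bases
  -- (row s₁ , j₁ + 1) and (row s₂ , j₁): both are one step from s₁ and equally far from s₂.
  confuse-columns : ∀ s₁ s₂ → row s₁ ≢ row s₂ → toℕ (col s₁) < toℕ (col s₂) → Confuse s₁ s₂
  confuse-columns s₁ s₂ a≢b j₁<j₂ =
    inj₁ (a , j₁⁺) , inj₁ (b , j₁) , (λ e → a≢b (cong row e)) ,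
    same-from-bases s₁ near-s₁ , same-from-bases s₂ near-s₂
    where
      a b : Fin n
      a = row s₁
      b = row s₂
      j₁ : Fin m
      j₁ = col s₁
      next : suc (toℕ j₁) < m
      next = ≤-<-trans j₁<j₂ (toℕ<n (col s₂))
      j₁⁺ : Fin m
      j₁⁺ = fromℕ< next
      near-s₁ : δ a a + gap j₁⁺ j₁ ≡ δ b a + gap j₁ j₁
      near-s₁ rewrite δ-refl a | δ-≢ (λ e → a≢b (sym e)) | toℕ-fromℕ< next | ∣n-n∣≡0 (toℕ j₁) =
        trans (∣-∣-comm (suc (toℕ j₁)) (toℕ j₁)) (∣n-1+n∣≡1 (toℕ j₁))
      near-s₂ : δ a b + gap j₁⁺ (col s₂) ≡ δ b b + gap j₁ (col s₂)
      near-s₂ rewrite δ-refl b | δ-≢ a≢b | toℕ-fromℕ< next = sym (∣m-n∣≡1+∣1+m-n∣ j₁<j₂)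

  pendant-twin : ∀ {c j′} (s : Vertex n m) → c ≢ row s → gap j′ (col s) ≡ 1 →
                 dist (inj₁ (c , j′)) s ≡ dist (inj₂ ((c , col s) , Fin.zero)) s
  pendant-twin (inj₁ (a , j))       c≢a g rewrite δ-≢ c≢a | g | ∣n-n∣≡0 (toℕ j) = refl
  pendant-twin (inj₂ ((a , j) , _)) c≢a g rewrite δ-≢ c≢a | g | ∣n-n∣≡0 (toℕ j) = refl

  confuse-pendant : ∀ s₁ s₂ (c : Fin n) → c ≢ row s₁ → c ≢ row s₂ → col s₁ ≡ col s₂ →
                    ∃[ j′ ] gap j′ (col s₁) ≡ 1 → Confuse s₁ s₂
  confuse-pendant s₁ s₂ c c≢a c≢b same-col (j′ , g) =
    inj₁ (c , j′) , inj₂ ((c , col s₁) , Fin.zero) , (λ ()) ,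
    pendant-twin s₁ c≢a g ,
    subst (λ j → dist (inj₁ (c , j′)) s₂ ≡ dist (inj₂ ((c , j) , Fin.zero)) s₂) (sym same-col)
          (pendant-twin s₂ c≢b (subst (λ j → gap j′ j ≡ 1) same-col g))

no-resolving-pair : ∀ {m′} (s₁ s₂ : Vertex 3 (2 + m′)) → ¬ Resolving (Γ 3 (2 + m′)) (s₁ ∷ s₂ ∷ [])
no-resolving-pair s₁ s₂ R with row s₁ Fin.≟ row s₂
... | yes same-row =
  let (i , i′ , i≢i′ , i∉ , i′∉) = missing-two (row s₁ ∷ []) ≤-refl
  in rows-hit R Fin.zero i≢i′ (widen i∉) (widen i′∉)
  where
    widen : ∀ {i} → i ∉ row s₁ ∷ [] → i ∉ rowsOf (s₁ ∷ s₂ ∷ [])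
    widen i∉ (here e)         = i∉ (here e)
    widen i∉ (there (here e)) = i∉ (here (trans e (sym same-row)))
... | no rows-differ with missing (row s₁ ∷ row s₂ ∷ []) ≤-refl
... | c , c∉ = no-resolving-confused confused R
  where
    c≢a : c ≢ row s₁
    c≢a e = c∉ (here e)
    c≢b : c ≢ row s₂
    c≢b e = c∉ (there (here e))
    confused : Confuse s₁ s₂
    confused with <-cmp (toℕ (col s₁)) (toℕ (col s₂))
    ... | tri< lt _ _ = confuse-columns s₁ s₂ rows-differ lt
    ... | tri> _ _ gt = confuse-swap (confuse-columns s₂ s₁ (λ e → rows-differ (sym e)) gt)
    ... | tri≈ _ eq _ = confuse-pendant s₁ s₂ c c≢a c≢b (toℕ-injective eq) (neighbour (col s₁))

three-lower : ∀ {m′} (S : List (Vertex 3 (2 + m′))) → Resolving (Γ 3 (2 + m′)) S → 3 ≤ length S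
three-lower []              R = ⊥-elim (<⇒≱ (s≤s z≤n) (lower-bound Fin.zero [] R))
three-lower (s ∷ [])        R = ⊥-elim (<⇒≱ ≤-refl (lower-bound Fin.zero (s ∷ []) R))
three-lower (s₁ ∷ s₂ ∷ [])  R = ⊥-elim (no-resolving-pair s₁ s₂ R)
three-lower (_ ∷ _ ∷ _ ∷ _) _ = s≤s (s≤s (s≤s z≤n))

-- If the distances from rows r and r′ to a, shifted by x and y, agree while x < y,
-- then r′ must be a itself (δ moves by at most 1).
shift-forces-row : ∀ {n} {r r′ a : Fin n} {x y} → δ r a + x ≡ δ r′ a + y → x < y → r′ ≡ a
shift-forces-row {r = r} {r′} {a} {x} {y} e x<y =
  d-zero (completeMetric _) (n≤0⇒n≡0 (+-cancelʳ-≤ (suc x) (δ r′ a) 0 bound))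
  where
    open ≤-Reasoning
    bound : δ r′ a + suc x ≤ 0 + suc x
    bound = begin
      δ r′ a + suc x ≤⟨ +-monoʳ-≤ (δ r′ a) x<y ⟩
      δ r′ a + y     ≡⟨ sym e ⟩
      δ r a + x      ≤⟨ +-monoˡ-≤ x (δ≤1 r a) ⟩
      suc x          ∎

-- Comparing with two different rows a ≠ b removes the row contribution.
equal-shifts : ∀ {n} {r r′ a b : Fin n} {x y} → a ≢ b →
               δ r a + x ≡ δ r′ a + y → δ r b + x ≡ δ r′ b + y → x ≡ y
equal-shifts {r = r} {r′} {x = x} {y} a≢b ea eb with <-cmp x y
... | tri≈ _ x≡y _ = x≡y
... | tri< x<y _ _ = ⊥-elim (a≢b (trans (sym (shift-forces-row {r = r} ea x<y))
                                         (shift-forces-row {r = r} eb x<y)))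
... | tri> _ _ y<x = ⊥-elim (a≢b (trans (sym (shift-forces-row {r = r′} (sym ea) y<x))
                                         (shift-forces-row {r = r′} (sym eb) y<x)))

bits-unique : ∀ {p p′ c c′} → p ≤ 1 → p′ ≤ 1 → c ≤ 1 → c′ ≤ 1 →
              p + p + c ≡ p′ + p′ + c′ → p ≡ p′ × c ≡ c′
bits-unique z≤n       z≤n       _   _    e    = refl , e
bits-unique (s≤s z≤n) (s≤s z≤n) _   _    e    = refl , suc-injective (suc-injective e)
bits-unique z≤n       (s≤s z≤n) (s≤s ()) _     refl
bits-unique (s≤s z≤n) z≤n       _     (s≤s ()) refl

rows-separated : ∀ {n} {L : List (Fin n)} {ℓ r r′ : Fin n} → (∀ x → x ∈ L ⊎ x ≡ ℓ) →
                 (∀ a → a ∈ L → δ r a ≡ δ r′ a) → r ≡ r′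
rows-separated {r = r} {r′} cover same with cover r | cover r′
... | inj₁ r∈ | _ = sym (d-zero (completeMetric _) (trans (sym (same r r∈)) (δ-refl r)))
... | _ | inj₁ r′∈ = d-zero (completeMetric _) (trans (same r′ r′∈) (δ-refl r′))
... | inj₂ r≡ℓ | inj₂ r′≡ℓ = trans r≡ℓ (sym r′≡ℓ)

module _ {n M : ℕ} where

  bottom top : Fin n → Vertex n (suc M)
  bottom a = inj₁ (a , Fin.zero)
  top    t = inj₁ (t , fromℕ M)

  landmarks : List (Fin n) → Fin n → List (Vertex n (suc M))
  landmarks A t = top t ∷ map bottom A

  -- Distance to the bottom of the path, counting the pendant edge.
  height : Vertex n (suc M) → ℕ
  height x = pen x + toℕ (col x)

  dist-to-bottom : ∀ x a → dist x (bottom a) ≡ δ (row x) a + height x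
  dist-to-bottom x a = begin
    dist x (bottom a)                           ≡⟨ dist-to-base x a Fin.zero ⟩
    pen x + (δ (row x) a + ∣ toℕ (col x) - 0 ∣) ≡⟨ cong (λ g → pen x + (δ (row x) a + g)) (∣-∣-identityʳ _) ⟩
    pen x + (δ (row x) a + toℕ (col x))        ≡⟨ x∙yz≈y∙xz (pen x) (δ (row x) a) (toℕ (col x)) ⟩
    δ (row x) a + height x                      ∎
    where open ≡-Reasoning

  height+dist-to-top : ∀ x t → height x + dist x (top t) ≡ pen x + pen x + δ (row x) t + M
  height+dist-to-top x t = begin
    (p + c) + dist x (top t)  ≡⟨ cong ((p + c) +_) (dist-to-base x t (fromℕ M)) ⟩
    (p + c) + (p + (e + g))   ≡⟨ interchange p c p (e + g) ⟩
    (p + p) + (c + (e + g))   ≡⟨ cong ((p + p) +_) (x∙yz≈y∙xz c e g) ⟩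
    (p + p) + (e + (c + g))   ≡⟨ cong (λ z → (p + p) + (e + z)) col+gap ⟩
    (p + p) + (e + M)         ≡⟨ sym (+-assoc (p + p) e M) ⟩
    p + p + e + M             ∎
    where
      open ≡-Reasoning
      p c e g : ℕ
      p = pen x
      c = toℕ (col x)
      e = δ (row x) t
      g = gap (col x) (fromℕ M)
      col+gap : c + g ≡ M
      col+gap = trans (cong (λ z → c + ∣ c - z ∣) (toℕ-fromℕ M))
                      (trans (cong (c +_) (m≤n⇒∣m-n∣≡n∸m c≤M)) (m+[n∸m]≡n c≤M))
        where
          c≤M : c ≤ M
          c≤M = ≤-pred (toℕ<n (col x))

  pen≤1 : ∀ (x : Vertex n (suc M)) → pen x ≤ 1
  pen≤1 (inj₁ _) = z≤n
  pen≤1 (inj₂ _) = s≤s z≤n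

  top-determines : ∀ u v t → height u ≡ height v → dist u (top t) ≡ dist v (top t) →
                   pen u ≡ pen v × col u ≡ col v × δ (row u) t ≡ δ (row v) t
  top-determines u v t same-height same-top with bits-unique (pen≤1 u) (pen≤1 v) (δ≤1 _ t) (δ≤1 _ t) bits
    where
      bits : pen u + pen u + δ (row u) t ≡ pen v + pen v + δ (row v) t
      bits = +-cancelʳ-≡ M _ _ (begin
        pen u + pen u + δ (row u) t + M ≡⟨ sym (height+dist-to-top u t) ⟩
        height u + dist u (top t)       ≡⟨ cong₂ _+_ same-height same-top ⟩
        height v + dist v (top t)       ≡⟨ height+dist-to-top v t ⟩
        pen v + pen v + δ (row v) t + M ∎)
        where open ≡-Reasoning
  ... | same-pen , same-δ = same-pen , toℕ-injective (+-cancelˡ-≡ (pen u) _ _ same-col-sum) , same-δ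
    where
      same-col-sum : pen u + toℕ (col u) ≡ pen u + toℕ (col v)
      same-col-sum = trans same-height (cong (_+ toℕ (col v)) (sym same-pen))

  landmarks-resolve : ∀ (A : List (Fin n)) t ℓ {a b} → a ∈ A → b ∈ A → a ≢ b →
                      (∀ x → x ∈ t ∷ A ⊎ x ≡ ℓ) → Resolving (Γ n (suc M)) (landmarks A t)
  landmarks-resolve A t ℓ {a} {b} a∈ b∈ a≢b cover = resolving (gridMetric n (suc M)) separated
    where
      separated : ∀ u v → (∀ s → s ∈ landmarks A t → dist u s ≡ dist v s) → u ≡ v
      separated u v same = vertex-ext u v (rows-separated cover same-δ) same-col same-pen
        where
          bottom-shift : ∀ a → a ∈ A → δ (row u) a + height u ≡ δ (row v) a + height v
          bottom-shift a a∈ = trans (sym (dist-to-bottom u a))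
            (trans (same (bottom a) (there (∈-map⁺ bottom a∈))) (dist-to-bottom v a))
          same-height : height u ≡ height v
          same-height = equal-shifts {r = row u} {row v} a≢b (bottom-shift a a∈) (bottom-shift b b∈)
          top-facts : pen u ≡ pen v × col u ≡ col v × δ (row u) t ≡ δ (row v) t
          top-facts = top-determines u v t same-height (same (top t) (here refl))
          same-pen : pen u ≡ pen v
          same-pen = proj₁ top-facts
          same-col : col u ≡ col v
          same-col = proj₁ (proj₂ top-facts)
          same-δ : ∀ r → r ∈ t ∷ A → δ (row u) r ≡ δ (row v) r
          same-δ _ (here refl) = proj₂ (proj₂ top-facts)
          same-δ r (there r∈)  = +-cancelʳ-≡ (height u) _ _
            (trans (bottom-shift r r∈) (cong (δ (row v) r +_) (sym same-height)))

module _ {n M′ : ℕ} where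

  -- With at least two columns the top and bottom landmarks are distinct.
  landmarks-unique : ∀ {A : List (Fin n)} t → Unique A → Unique (landmarks {n} {suc M′} A t)
  landmarks-unique {A} t unique-A = top-not-bottom A ∷ Unique.map⁺ bottom-injective unique-A
    where
      bottom-injective : ∀ {a a′} → bottom {n} {suc M′} a ≡ bottom a′ → a ≡ a′
      bottom-injective refl = refl
      top-not-bottom : ∀ A → All (top {n} {suc M′} t ≢_) (map bottom A)
      top-not-bottom []      = []
      top-not-bottom (_ ∷ A) = (λ ()) ∷ top-not-bottom A

  landmarks-length : ∀ (A : List (Fin n)) t → length (landmarks {n} {suc M′} A t) ≡ suc (length A)
  landmarks-length A t = cong suc (length-map bottom A)

-- n ≥ 4: rows 2, …, n-1 at the bottom and row 0 at the top; only row 1 is missed.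
dim-large : ∀ {n} m′ → 4 ≤ n → MetricDim (Γ n (2 + m′)) (n ∸ 1)
dim-large {suc (suc k)} m′ (s≤s (s≤s (s≤s (s≤s _)))) =
  (landmarks A Fin.zero , landmarks-unique Fin.zero unique-A ,
   trans (landmarks-length A Fin.zero) (cong suc (length-tabulate shift)) ,
   landmarks-resolve A Fin.zero (Fin.suc Fin.zero)
     (∈-tabulate⁺ {f = shift} Fin.zero) (∈-tabulate⁺ {f = shift} (Fin.suc Fin.zero)) (λ ()) cover) ,
  λ S _ → lower-bound Fin.zero S
  where
    shift : Fin k → Fin (2 + k)
    shift i = Fin.suc (Fin.suc i)
    A : List (Fin (2 + k))
    A = tabulate shift
    unique-A : Unique A
    unique-A = Unique.tabulate⁺ (Finₚ.suc-injective ∘ Finₚ.suc-injective)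
    cover : ∀ x → x ∈ Fin.zero ∷ A ⊎ x ≡ Fin.suc Fin.zero
    cover Fin.zero              = inj₁ (here refl)
    cover (Fin.suc Fin.zero)    = inj₂ refl
    cover (Fin.suc (Fin.suc i)) = inj₁ (there (∈-tabulate⁺ {f = shift} i))

-- n = 3: rows 1, 2 at the bottom and row 0 at the top; by three-lower nothing smaller works.
dim-three : ∀ m′ → MetricDim (Γ 3 (2 + m′)) 3
dim-three m′ =
  (landmarks A Fin.zero , landmarks-unique Fin.zero unique-A , refl ,
   landmarks-resolve A Fin.zero Fin.zero (here refl) (there (here refl)) (λ ()) cover) ,
  λ S _ → three-lower S
  where
    A : List (Fin 3)
    A = Fin.suc Fin.zero ∷ Fin.suc (Fin.suc Fin.zero) ∷ []
    unique-A : Unique A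
    unique-A = ((λ ()) ∷ []) ∷ [] ∷ []
    cover : ∀ x → x ∈ Fin.zero ∷ A ⊎ x ≡ Fin.zero
    cover Fin.zero                     = inj₁ (here refl)
    cover (Fin.suc Fin.zero)           = inj₁ (there (here refl))
    cover (Fin.suc (Fin.suc Fin.zero)) = inj₁ (there (there (here refl)))

mainTheorem2 : ∀ (n m : ℕ) → 2 ≤ m →
    (4 ≤ n → MetricDim ((K n □ P m) ⊙ K 1) (n ∸ 1))
    × (n ≡ 3 → MetricDim ((K n □ P m) ⊙ K 1) 3)
mainTheorem2 n (suc (suc m′)) (s≤s (s≤s z≤n)) = dim-large m′ , λ { refl → dim-three m′ }
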